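{- In the $(1:1)$ WMaker--WBreaker game on $E(K_n)$, if WMaker plays according to strategy $\mathcal{S}$, then every vertex $x\in U$ satisfies $d_B(x)\le 6$ at the moment when WMaker visits it for the first time.
   Context: The $(1:1)$ WMaker--WBreaker game on $E(K_n)$: WMaker and WBreaker alternately claim one edge of $K_n$ per turn; both are walkers: at the first move a player chooses any starting vertex; when positioned at $v$, a player may only claim an edge incident with $v$ not previously claimed by the opponent, and its other endpoint becomes the new position. WBreaker starts; a round is a move of WBreaker followed by a move of WMaker. A vertex is visited by a player once that player has claimed at least one edge incident with it. $M$ and $B$ denote the graphs of edges claimed so far by WMaker and WBreaker; $V(M)$ is the set of vertices visited by WMaker, and $U=V(K_n)\setminus V(M)$. An edge is free if claimed by neither player. $d_B(x)$ is the degree of $x$ in $B$. Strategy $\mathcal{S}$ for WMaker: as her starting vertex she takes the vertex $v_1$ at which WBreaker finished his first move, and claims an edge $v_1u$ with $d_B(u)=0$ (ties arbitrary). In every later round, with current position $w$: if there is an edge $pq\in E(B)$ with $p,q\in U$, she claims $wp$ or $wq$, whichever is free; if both are free she chooses $wp$ if $d_B(p)>d_B(q)$ and $wq$ if $d_B(q)>d_B(p)$ (ties arbitrary). If no such edge exists, then, as long as $|U|\ge 3$, she claims a free edge $wu$ with $u\in U$ and $d_B(u)=\max\{d_B(v):v\in U\}$ (ties arbitrary); if all free edges $wu$ are such that $d_B(u)=0$ for all $u\in U$, she claims an arbitrary free edge $wu$. -}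

module Defs where

open import Data.Nat using (ℕ; _≤_)
open import Data.Bool using (Bool; true; false; if_then_else_; _∧_; _∨_; not)
open import Data.Fin using (Fin; _≟_)
open import Data.List using (List; allFin; map)
open import Data.Nat.ListAction using (sum)
open import Data.Bool.ListAction using (any)
open import Data.Empty using (⊥)
open import Relation.Nullary using (¬_)
open import Relation.Nullary.Decidable using (⌊_⌋)
open import Relation.Binary.PropositionalEquality using (_≡_)
open import Data.Product using (Σ; _×_)

-- A graph on the vertex set of K_n (vertices Fin n), given by a Bool
-- adjacency relation.  All graphs built below are symmetric and loopless.
Graph : ℕ → Set
Graph n = Fin n → Fin n → Bool

emptyG : ∀ {n} → Graph n
emptyG _ _ = false

addEdge : ∀ {n} → Graph n → Fin n → Fin n → Graph n
addEdge G x y a b =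
  (⌊ a ≟ x ⌋ ∧ ⌊ b ≟ y ⌋) ∨ (⌊ a ≟ y ⌋ ∧ ⌊ b ≟ x ⌋) ∨ G a b

deg : ∀ {n} → Graph n → Fin n → ℕ
deg {n} G x = sum (map (λ y → if G x y then 1 else 0) (allFin n))

visitedᵇ : ∀ {n} → Graph n → Fin n → Bool
visitedᵇ {n} G x = any (G x) (allFin n)

-- x ∈ U  (not yet visited by WMaker, whose graph is M)
InU : ∀ {n} → Graph n → Fin n → Set
InU M x = visitedᵇ M x ≡ false

Visited : ∀ {n} → Graph n → Fin n → Set
Visited M x = visitedᵇ M x ≡ true

sizeU : ∀ {n} → Graph n → ℕ
sizeU {n} M = sum (map (λ x → if visitedᵇ M x then 0 else 1) (allFin n))

Free : ∀ {n} → Graph n → Graph n → Fin n → Fin n → Set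
Free B M w u = (¬ w ≡ u) × (B w u ≡ false) × (M w u ≡ false)

NoBEdgeInU : ∀ {n} → Graph n → Graph n → Set
NoBEdgeInU B M = ∀ p q → B p q ≡ true → InU M p → InU M q → ⊥

-- SMove first B M w u : with WBreaker's graph B, WMaker's graph M and
-- WMaker's current position w, strategy S allows WMaker to claim wu.
-- first = true marks WMaker's very first move (w is then v₁, the vertex at
-- which WBreaker finished his first move).
data SMove {n : ℕ} : Bool → Graph n → Graph n → Fin n → Fin n → Set where
  opening : ∀ {B M w u} → Free B M w u → deg B u ≡ 0 → SMove true B M w u
  pairRule : ∀ {B M w} (p q : Fin n) → B p q ≡ true → InU M p → InU M q →
             Free B M w p → (Free B M w q → deg B q ≤ deg B p) →
             SMove false B M w p
  maxRule : ∀ {B M w u} → NoBEdgeInU B M → 3 ≤ sizeU M →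
            Free B M w u → InU M u → (∀ v → InU M v → deg B v ≤ deg B u) →
            SMove false B M w u
  zeroRule : ∀ {B M w u} → NoBEdgeInU B M → (∀ v → InU M v → deg B v ≡ 0) →
             Free B M w u → SMove false B M w u

-- PreMaker first B M w b : B, M are the graphs claimed so far, w is WMaker's
-- position (for her first move: v₁ = WBreaker's position), b is WBreaker's
-- position.  WBreaker starts; a WBreaker walker move from b claims an edge
-- by (b ≠ y) not previously claimed by WMaker.
data PreMaker {n : ℕ} : Bool → Graph n → Graph n → Fin n → Fin n → Set where
  start : (s y : Fin n) → ¬ s ≡ y →
          PreMaker true (addEdge emptyG s y) emptyG y y
  round : ∀ {first B M w b} → PreMaker first B M w b →
          (u : Fin n) → SMove first B M w u →
          (y : Fin n) → ¬ b ≡ y → addEdge M w u b y ≡ false →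
          PreMaker false (addEdge B b y) (addEdge M w u) u y

-- WMaker in fact keeps the B-degree of every vertex of U at most 3.  Call a vertex exposed
-- when it lies in U and WBreaker has already claimed an edge at it.  Right after each WMaker
-- move at most one vertex is exposed, its B-degree is at most 2, and at most 1 if it is
-- WBreaker's current position.  This survives a round: WBreaker's walk adds a single edge and so
-- exposes at most its new endpoint y, while every rule of S moves WMaker onto an exposed vertex
-- whenever there is one (under the maximum rule, the maximal degree in U is then positive), and
-- that vertex leaves U.  Since a WBreaker move raises any degree by at most one, every vertex of
-- U has B-degree at most 3 when WMaker is about to move.
module Submission where

open import Defs
open import Data.Nat using (ℕ; _≤_; suc; _+_; z≤n; s≤s)
open import Data.Nat.Properties
  using (≤-trans; ≤-reflexive; +-mono-≤; +-monoˡ-≤; module ≤-Reasoning; m≤m+n; m≤n+m; n≤1+n;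
         m<n⇒n≢0; n≤0⇒n≡0; +-commutativeSemigroup)
  renaming (_≟_ to _≟ℕ_)
open import Algebra.Properties.CommutativeSemigroup +-commutativeSemigroup using (interchange)
open import Data.Nat.ListAction using (sum)
open import Data.Bool using (Bool; true; false; if_then_else_; _∧_; _∨_)
open import Data.Bool.Properties using (∨-zeroʳ; T-≡; ¬-not; not-¬)
open import Data.Fin using (Fin; zero; suc; _≟_)
open import Data.List using (List; []; _∷_; map; allFin)
open import Data.List.Properties using (map-cong; map-tabulate)
open import Data.List.Membership.Propositional using (_∈_; lose)
open import Data.List.Membership.Propositional.Properties using (∈-allFin; ∈-map⁺)
open import Data.List.Relation.Unary.Any using (here; there; satisfied)
open import Data.List.Relation.Unary.Any.Properties using (any⁺; any⁻)
open import Data.Sum using (_⊎_; inj₁; inj₂)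
open import Data.Product using (∃; _×_; _,_; proj₁)
open import Function using (id; Equivalence)
open import Relation.Nullary using (¬_; yes; no; contradiction)
open import Relation.Nullary.Decidable using (⌊_⌋; ⌊⌋-map′)
open import Relation.Binary.PropositionalEquality
  using (_≡_; _≢_; refl; sym; trans; cong; subst)

private
  variable
    n : ℕ
    B M : Graph n
    a b u w y z : Fin n

-- deg G a is definitionally sum (map (λ i → ind (G a i)) (allFin n)).
ind : Bool → ℕ
ind p = if p then 1 else 0

ind-∨ : ∀ p r → ind (p ∨ false ∨ r) ≤ ind p + ind r
ind-∨ true  _     = s≤s z≤n
ind-∨ false true  = s≤s z≤n
ind-∨ false false = z≤n

sum-map-mono : ∀ {A : Set} {f g : A → ℕ} → (∀ x → f x ≤ g x) →
               ∀ xs → sum (map f xs) ≤ sum (map g xs)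
sum-map-mono f≤g []       = z≤n
sum-map-mono f≤g (x ∷ xs) = +-mono-≤ (f≤g x) (sum-map-mono f≤g xs)

sum-map-+ : ∀ {A : Set} (f g : A → ℕ) xs →
            sum (map (λ x → f x + g x) xs) ≡ sum (map f xs) + sum (map g xs)
sum-map-+ f g []       = refl
sum-map-+ f g (x ∷ xs) =
  trans (cong (f x + g x +_) (sum-map-+ f g xs)) (interchange (f x) (g x) _ _)

sum-map-0 : ∀ {A : Set} (xs : List A) → sum (map (λ _ → 0) xs) ≡ 0
sum-map-0 []       = refl
sum-map-0 (_ ∷ xs) = sum-map-0 xs

∈⇒≤sum : ∀ {m ms} → m ∈ ms → m ≤ sum ms
∈⇒≤sum {ms = m ∷ ms} (here refl) = m≤m+n m (sum ms)
∈⇒≤sum {ms = m ∷ ms} (there p)   = ≤-trans (∈⇒≤sum p) (m≤n+m (sum ms) m)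

sum-map-allFin-suc : ∀ (f : Fin (suc n) → ℕ) →
  sum (map f (allFin (suc n))) ≡ f zero + sum (map (λ i → f (suc i)) (allFin n))
sum-map-allFin-suc f =
  cong (λ xs → f zero + sum xs) (trans (map-tabulate suc f) (sym (map-tabulate id _)))

count-≟-≤1 : ∀ n (c : Fin n) → sum (map (λ i → ind ⌊ i ≟ c ⌋) (allFin n)) ≤ 1
count-≟-≤1 (suc n) zero = begin
  sum (map (λ i → ind ⌊ i ≟ zero ⌋) (allFin (suc n)))      ≡⟨ sum-map-allFin-suc {n} (λ i → ind ⌊ i ≟ zero ⌋) ⟩
  1 + sum (map (λ _ → 0) (allFin n))                      ≡⟨ cong (1 +_) (sum-map-0 (allFin n)) ⟩
  1                                                       ∎
  where open ≤-Reasoning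
count-≟-≤1 (suc n) (suc c) = begin
  sum (map (λ i → ind ⌊ i ≟ suc c ⌋) (allFin (suc n)))     ≡⟨ sum-map-allFin-suc (λ i → ind ⌊ i ≟ suc c ⌋) ⟩
  sum (map (λ i → ind ⌊ suc i ≟ suc c ⌋) (allFin n))       ≡⟨ cong sum (map-cong suc≟suc (allFin n)) ⟩
  sum (map (λ i → ind ⌊ i ≟ c ⌋) (allFin n))               ≤⟨ count-≟-≤1 n c ⟩
  1                                                       ∎
  where
  open ≤-Reasoning
  suc≟suc : ∀ i → ind ⌊ suc i ≟ suc c ⌋ ≡ ind ⌊ i ≟ c ⌋
  suc≟suc i = cong ind (⌊⌋-map′ _ _ (i ≟ c))

addEdge-⊇ : ∀ (G : Graph n) b y → G a z ≡ true → addEdge G b y a z ≡ true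
addEdge-⊇ {a = a} {z = z} G b y e rewrite e =
  trans (cong (⌊ a ≟ b ⌋ ∧ ⌊ z ≟ y ⌋ ∨_) (∨-zeroʳ (⌊ a ≟ y ⌋ ∧ ⌊ z ≟ b ⌋)))
        (∨-zeroʳ (⌊ a ≟ b ⌋ ∧ ⌊ z ≟ y ⌋))

addEdge-edge : ∀ (G : Graph n) a c → addEdge G a c a c ≡ true
addEdge-edge G a c with a ≟ a | c ≟ c
... | yes _ | yes _ = refl
... | no a≢a | _     = contradiction refl a≢a
... | _     | no c≢c = contradiction refl c≢c

addEdge-edgeʳ : ∀ (G : Graph n) a c → addEdge G a c c a ≡ true
addEdge-edgeʳ G a c with c ≟ c | a ≟ a
... | yes _ | yes _ = ∨-zeroʳ (⌊ c ≟ a ⌋ ∧ ⌊ a ≟ c ⌋)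
... | no c≢c | _     = contradiction refl c≢c
... | _     | no a≢a = contradiction refl a≢a

deg-emptyG : ∀ (a : Fin n) → deg emptyG a ≡ 0
deg-emptyG {n} _ = sum-map-0 (allFin n)

edge⇒deg≢0 : ∀ (G : Graph n) a → G a z ≡ true → deg G a ≢ 0
edge⇒deg≢0 {z = z} G a e = m<n⇒n≢0 (subst (λ p → ind p ≤ deg G a) e ind≤deg)
  where ind≤deg : ind (G a z) ≤ deg G a
        ind≤deg = ∈⇒≤sum (∈-map⁺ (λ i → ind (G a i)) (∈-allFin z))

addEdge-adds-one-neighbour : ∀ (G : Graph n) b y a → b ≢ y →
  ∃ λ c → ∀ i → ind (addEdge G b y a i) ≤ ind ⌊ i ≟ c ⌋ + ind (G a i)
addEdge-adds-one-neighbour G b y a b≢y with a ≟ b | a ≟ y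
... | yes refl | yes refl = contradiction refl b≢y
... | yes refl | no _     = y , λ i → ind-∨ ⌊ i ≟ y ⌋ (G a i)
... | no _     | yes refl = b , λ i → ind-∨ ⌊ i ≟ b ⌋ (G a i)
... | no _     | no _     = b , λ i → m≤n+m _ _

deg-addEdge-≤ : ∀ (G : Graph n) b y a → b ≢ y → deg (addEdge G b y) a ≤ suc (deg G a)
deg-addEdge-≤ {n} G b y a b≢y with addEdge-adds-one-neighbour G b y a b≢y
... | c , row≤ = begin
  deg (addEdge G b y) a                                          ≤⟨ sum-map-mono row≤ (allFin n) ⟩
  sum (map (λ i → ind ⌊ i ≟ c ⌋ + ind (G a i)) (allFin n))        ≡⟨ sum-map-+ _ _ (allFin n) ⟩
  sum (map (λ i → ind ⌊ i ≟ c ⌋) (allFin n)) + deg G a            ≤⟨ +-monoˡ-≤ (deg G a) (count-≟-≤1 n c) ⟩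
  suc (deg G a)                                                  ∎
  where open ≤-Reasoning

deg-addEdge-untouched : ∀ (G : Graph n) b y a → a ≡ b ⊎ a ≡ y ⊎ deg (addEdge G b y) a ≡ deg G a
deg-addEdge-untouched G b y a with a ≟ b | a ≟ y
... | yes a≡b | _       = inj₁ a≡b
... | no _    | yes a≡y = inj₂ (inj₁ a≡y)
... | no _    | no _    = inj₂ (inj₂ refl)

deg-single-edge-≤1 : ∀ {s y : Fin n} → s ≢ y → deg (addEdge emptyG s y) a ≤ 1
deg-single-edge-≤1 {a = a} {s} {y} s≢y =
  subst (λ k → deg (addEdge emptyG s y) a ≤ suc k) (deg-emptyG a) (deg-addEdge-≤ emptyG s y a s≢y)

edge⇒Visited : ∀ (M : Graph n) a → M a z ≡ true → Visited M a
edge⇒Visited {z = z} M a e =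
  Equivalence.to T-≡ (any⁺ (M a) (lose (∈-allFin z) (Equivalence.from T-≡ e)))

Visited⇒edge : ∀ (M : Graph n) a → Visited M a → ∃ λ z → M a z ≡ true
Visited⇒edge {n} M a v with satisfied (any⁻ (M a) (allFin n) (Equivalence.from T-≡ v))
... | z , t = z , Equivalence.to T-≡ t

InU⇒¬Visited : ∀ (M : Graph n) a → InU M a → ¬ Visited M a
InU⇒¬Visited _ _ = not-¬

Visited-addEdge : ∀ (M : Graph n) w u a → Visited M a → Visited (addEdge M w u) a
Visited-addEdge M w u a v with Visited⇒edge M a v
... | z , e = edge⇒Visited (addEdge M w u) a (addEdge-⊇ M w u e)

InU-addEdge⁻ : ∀ (M : Graph n) w u a → InU (addEdge M w u) a → InU M a
InU-addEdge⁻ M w u a Ua =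
  ¬-not (λ v → InU⇒¬Visited (addEdge M w u) a Ua (Visited-addEdge M w u a v))

¬InU-addEdgeˡ : ∀ (M : Graph n) w u → ¬ InU (addEdge M w u) w
¬InU-addEdgeˡ M w u Uw =
  InU⇒¬Visited (addEdge M w u) w Uw (edge⇒Visited (addEdge M w u) w (addEdge-edge M w u))

¬InU-addEdgeʳ : ∀ (M : Graph n) w u → ¬ InU (addEdge M w u) u
¬InU-addEdgeʳ M w u Uu =
  InU⇒¬Visited (addEdge M w u) u Uu (edge⇒Visited (addEdge M w u) u (addEdge-edgeʳ M w u))

AtMostOne : {A : Set} → (A → Set) → Set
AtMostOne P = ∀ {a a'} → P a → P a' → a ≡ a'

atMostOne-insert-delete : ∀ {A : Set} {P : A → Set} {y u : A} → AtMostOne P →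
  u ≡ y ⊎ P u → AtMostOne (λ a → (a ≡ y ⊎ P a) × a ≢ u)
atMostOne-insert-delete _ _ (inj₁ refl , _) (inj₁ refl , _) = refl
atMostOne-insert-delete _ (inj₁ refl) (inj₁ refl , a≢u) (inj₂ _ , _) = contradiction refl a≢u
atMostOne-insert-delete P≤1 (inj₂ Pu) (inj₁ _ , _) (inj₂ Pa' , a'≢u) = contradiction (P≤1 Pa' Pu) a'≢u
atMostOne-insert-delete _ (inj₁ refl) (inj₂ _ , _) (inj₁ refl , a'≢u) = contradiction refl a'≢u
atMostOne-insert-delete P≤1 (inj₂ Pu) (inj₂ Pa , a≢u) (inj₁ _ , _) = contradiction (P≤1 Pa Pu) a≢u
atMostOne-insert-delete P≤1 _ (inj₂ Pa , _) (inj₂ Pa' , _) = P≤1 Pa Pa'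

record Exposed (B M : Graph n) (a : Fin n) : Set where
  constructor _,_
  field
    unvisited : InU M a
    touched   : deg B a ≢ 0

SMove-target-Exposed : SMove false B M w u → Exposed B M a → Exposed B M u
SMove-target-Exposed {B = B} (pairRule p q Bpq Up _ _ _) _ = Up , edge⇒deg≢0 B p Bpq
SMove-target-Exposed {B = B} {a = a} (maxRule _ _ _ Uu maximal) (Ua , da≢0) =
  Uu , λ du≡0 → da≢0 (n≤0⇒n≡0 (subst (deg B a ≤_) du≡0 (maximal a Ua)))
SMove-target-Exposed (zeroRule _ allZero _) (Ua , da≢0) = contradiction (allZero _ Ua) da≢0

Exposed-breaker-move⁻ : ∀ {b y} → deg B b ≢ 0 → Exposed (addEdge B b y) M a → a ≡ y ⊎ Exposed B M a
Exposed-breaker-move⁻ {B = B} {a = a} {b} {y} db≢0 (Ua , da≢0) with deg-addEdge-untouched B b y a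
... | inj₁ refl            = inj₂ (Ua , db≢0)
... | inj₂ (inj₁ a≡y)      = inj₁ a≡y
... | inj₂ (inj₂ same-deg) = inj₂ (Ua , subst (_≢ 0) same-deg da≢0)

Exposed-maker-move⁻ : Exposed B (addEdge M w u) a → Exposed B M a × a ≢ u
Exposed-maker-move⁻ {M = M} {w} {u} {a} (Ua , da≢0) =
  (InU-addEdge⁻ M w u a Ua , da≢0) , λ { refl → ¬InU-addEdgeʳ M w u Ua }

record Invariant (B M : Graph n) (b : Fin n) : Set where
  field
    position-deg≢0         : deg B b ≢ 0
    exposed-unique         : AtMostOne (Exposed B M)
    exposed-deg≤2          : Exposed B M a → deg B a ≤ 2
    exposed-position-deg≤1 : Exposed B M b → deg B b ≤ 1

invariant-start : ∀ {s y u : Fin n} → s ≢ y →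
                  Invariant (addEdge emptyG s y) (addEdge emptyG y u) y
invariant-start {s = s} {y} {u} s≢y = record
  { position-deg≢0         = edge⇒deg≢0 (addEdge emptyG s y) y (addEdge-edgeʳ emptyG s y)
  ; exposed-unique         = λ ea ea' → trans (is-s ea) (sym (is-s ea'))
  ; exposed-deg≤2          = λ {a} _ → ≤-trans (deg-single-edge-≤1 {a = a} s≢y) (n≤1+n 1)
  ; exposed-position-deg≤1 = λ (Uy , _) → contradiction Uy (¬InU-addEdgeˡ emptyG y u)
  }
  where
  is-s : Exposed (addEdge emptyG s y) (addEdge emptyG y u) a → a ≡ s
  is-s {a} (Ua , da≢0) with deg-addEdge-untouched emptyG s y a
  ... | inj₁ a≡s            = a≡s
  ... | inj₂ (inj₁ refl)     = contradiction Ua (¬InU-addEdgeˡ emptyG y u)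
  ... | inj₂ (inj₂ same-deg) = contradiction (trans same-deg (deg-emptyG a)) da≢0

invariant-step : Invariant B M b → b ≢ y → SMove false (addEdge B b y) M w u →
                 Invariant (addEdge B b y) (addEdge M w u) y
invariant-step {B = B} {M} {b} {y} {w} {u} inv b≢y move = record
  { position-deg≢0         = edge⇒deg≢0 (addEdge B b y) y (addEdge-edgeʳ B b y)
  ; exposed-unique         = λ ea ea' →
      atMostOne-insert-delete exposed-unique (old-or-new (u-exposed ea)) (trace ea) (trace ea')
  ; exposed-deg≤2          = deg≤2
  ; exposed-position-deg≤1 = y-deg≤1
  }
  where
  open Invariant inv
  B′ = addEdge B b y
  M′ = addEdge M w u

  old-or-new : Exposed B′ M a → a ≡ y ⊎ Exposed B M a
  old-or-new = Exposed-breaker-move⁻ position-deg≢0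

  u-exposed : Exposed B′ M′ a → Exposed B′ M u
  u-exposed ea = SMove-target-Exposed move (proj₁ (Exposed-maker-move⁻ ea))

  trace : Exposed B′ M′ a → (a ≡ y ⊎ Exposed B M a) × a ≢ u
  trace ea with Exposed-maker-move⁻ ea
  ... | eaM , a≢u = old-or-new eaM , a≢u

  y-deg≤1 : Exposed B′ M′ y → deg B′ y ≤ 1
  y-deg≤1 ey with deg B y ≟ℕ 0 | Exposed-maker-move⁻ ey
  ... | yes dy≡0 | _ = subst (λ k → deg B′ y ≤ suc k) dy≡0 (deg-addEdge-≤ B b y y b≢y)
  ... | no dy≢0 | (Uy , _) , y≢u with old-or-new (u-exposed ey)
  ...   | inj₁ u≡y = contradiction (sym u≡y) y≢u
  ...   | inj₂ eu  = contradiction (exposed-unique (Uy , dy≢0) eu) y≢u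

  deg≤2 : Exposed B′ M′ a → deg B′ a ≤ 2
  deg≤2 {a} ea with trace {a} ea
  ... | inj₁ refl , _ = ≤-trans (y-deg≤1 ea) (n≤1+n 1)
  ... | inj₂ eaM  , _ with deg-addEdge-untouched B b y a
  ...   | inj₁ refl            = ≤-trans (deg-addEdge-≤ B b y b b≢y) (s≤s (exposed-position-deg≤1 eaM))
  ...   | inj₂ (inj₁ refl)     = ≤-trans (y-deg≤1 ea) (n≤1+n 1)
  ...   | inj₂ (inj₂ same-deg) = ≤-trans (≤-reflexive same-deg) (exposed-deg≤2 eaM)

invariant : ∀ {first} → PreMaker first B M w b → SMove first B M w u →
            Invariant B (addEdge M w u) b
invariant (start s y s≢y)             (opening _ _) = invariant-start s≢y
invariant (round game _ move₀ _ b≢y _) move         = invariant-step (invariant game move₀) b≢y move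

InU-deg≤3 : ∀ {first x} → PreMaker first B M w b → InU M x → deg B x ≤ 3
InU-deg≤3 {x = x} (start s y s≢y) _ = ≤-trans (deg-single-edge-≤1 {a = x} s≢y) (m≤m+n 1 2)
InU-deg≤3 {x = x} (round {B = B} {b = b} game _ move y b≢y _) Ux =
  ≤-trans (deg-addEdge-≤ B b y x b≢y) (s≤s old-deg≤2)
  where
  old-deg≤2 : deg B x ≤ 2
  old-deg≤2 with deg B x ≟ℕ 0
  ... | yes dx≡0 = subst (_≤ 2) (sym dx≡0) z≤n
  ... | no dx≢0  = Invariant.exposed-deg≤2 (invariant game move) (Ux , dx≢0)

lemma3 : ∀ {n : ℕ} {first : Bool} {B M : Graph n} {w b : Fin n} →
    PreMaker first B M w b →
    (u : Fin n) → SMove first B M w u →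
    (x : Fin n) → InU M x → Visited (addEdge M w u) x →
    deg B x ≤ 6
lemma3 game _ _ _ Ux _ = ≤-trans (InU-deg≤3 game Ux) (m≤m+n 3 3)
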